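{- If $D=(V,A)$ is a finite, connected and acyclic digraph with a U-coloring $c$, then $D$ is a cover graph, and its transitive closure is a U-poset $P_D$ which has a rank function and a greatest element $\mathbf{1}$.
   Context: For a digraph $D=(V,A)$, an arc coloring $c$ is a U-coloring if for all $u,v,w\in V$ with $u\neq w$ and $(v,u),(v,w)\in A$: (U$_1$) $c(v,u)\neq c(v,w)$; (U$_2$) there is $z\in V$ with arcs $(u,z),(w,z)\in A$ such that $c(v,u)=c(w,z)$ and $c(v,w)=c(u,z)$. A finite poset is a U-poset if the arcs of its cover graph (arc $(x,y)$ whenever $y$ covers $x$) admit a U-coloring. -}

module Defs where

open import Data.Nat using (ℕ; suc)
open import Data.Fin using (Fin)
open import Data.Bool using (Bool; true)
open import Data.Product using (Σ; ∃; _×_; _,_)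
open import Relation.Nullary using (¬_)
open import Relation.Binary.PropositionalEquality using (_≡_; _≢_)
open import Relation.Binary.Core using (Rel)
open import Level using (0ℓ)
open import Relation.Binary.Structures using (IsPartialOrder)
open import Relation.Binary.Construct.Closure.Transitive using (TransClosure)
open import Relation.Binary.Construct.Closure.ReflexiveTransitive using (Star)
open import Relation.Binary.Construct.Closure.Symmetric using (SymClosure)

Digraph : ℕ → Set
Digraph n = Fin n → Fin n → Bool

Arc : ∀ {n} → Digraph n → Rel (Fin n) 0ℓ
Arc A u v = A u v ≡ true

-- (weakly) connected: nonempty, and any two vertices are joined by a path
-- in the underlying undirected graph
Connected : ∀ {n} → Digraph n → Set
Connected {n} A = Fin n × (∀ (x y : Fin n) → Star (SymClosure (Arc A)) x y)

Acyclic : ∀ {n} → Digraph n → Set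
Acyclic {n} A = ∀ (x : Fin n) → ¬ TransClosure (Arc A) x x

-- U-coloring of a digraph given by an arc relation R, with colours in C.
-- c is a function on all ordered pairs; only its values on arcs matter.
IsUColoring : ∀ {n} {C : Set} → Rel (Fin n) 0ℓ → (Fin n → Fin n → C) → Set
IsUColoring {n} R c =
  ∀ (u v w : Fin n) → u ≢ w → R v u → R v w →
    (c v u ≢ c v w) ×
    (∃ λ z → R u z × R w z × (c v u ≡ c w z) × (c v w ≡ c u z))

_<D_ : ∀ {n} → Digraph n → Rel (Fin n) 0ℓ
_<D_ A = TransClosure (Arc A)

_≤D_ : ∀ {n} → Digraph n → Rel (Fin n) 0ℓ
_≤D_ A = Star (Arc A)

Covers : ∀ {n} → Rel (Fin n) 0ℓ → Rel (Fin n) 0ℓ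
Covers {n} _<_ x y = (x < y) × (¬ (∃ λ (z : Fin n) → (x < z) × (z < y)))

IsUPoset : ∀ {n} → Rel (Fin n) 0ℓ → Set₁
IsUPoset {n} _<_ =
  Σ Set λ C → Σ (Fin n → Fin n → C) λ c → IsUColoring (Covers _<_) c

HasRankFunction : ∀ {n} → Rel (Fin n) 0ℓ → Set
HasRankFunction {n} _<_ =
  ∃ λ (r : Fin n → ℕ) → ∀ (x y : Fin n) → Covers _<_ x y → r y ≡ suc (r x)

HasGreatest : ∀ {n} → Rel (Fin n) 0ℓ → Set
HasGreatest {n} _≤_ = ∃ λ (t : Fin n) → ∀ (x : Fin n) → x ≤ t

IsCoverGraphOfClosure : ∀ {n} → Digraph n → Set
IsCoverGraphOfClosure {n} A =
  ∀ (x y : Fin n) → (Arc A x y → Covers (_<D_ A) x y) × (Covers (_<D_ A) x y → Arc A x y)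

-- Call a vertex with no outgoing arc a sink.  By well-founded induction on the
-- acyclic digraph, every vertex x reaches exactly one sink, and every directed
-- path from x to a sink has the same length h(x): if x has two distinct
-- successors, U₂ gives them a common successor z, and the inductive
-- hypothesis at z makes their sinks and heights agree.  Hence every arc lowers
-- h by exactly one, so arcs are covers of the transitive closure (no shortcut
-- can exist), max h ∸ h is a rank function, and in a connected digraph all
-- vertices share one sink, the greatest element.
module Submission where

open import Defs
open import Data.Nat using (ℕ; suc; _≤_; _<_; _∸_)
open import Data.Nat.Properties
  using (≤-refl; ≤-trans; <-trans; ≤-reflexive; n≤1+n; 1+n≰n; <⇒≱; m<1+n⇒m≤n; +-∸-assoc)
open import Data.Fin using (Fin)
open import Data.Fin.Properties using (any?; _≟_)
open import Data.Fin.Induction using (spo-noetherian)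
open import Data.Bool using (true)
import Data.Bool.Properties as Bool
open import Data.List using (map; allFin)
open import Data.List.Extrema.Nat using (max; xs≤max)
open import Data.List.Relation.Unary.All using (lookup)
open import Data.List.Membership.Propositional.Properties using (∈-map⁺; ∈-allFin)
open import Data.Product using (_×_; _,_; ∃; proj₁; proj₂)
open import Data.Empty using (⊥-elim)
open import Relation.Nullary using (¬_; yes; no)
open import Relation.Binary.Core using (Rel)
open import Relation.Binary.Definitions using (Decidable)
open import Relation.Binary.Structures using (IsPartialOrder)
open import Relation.Binary.PropositionalEquality
  using (_≡_; _≢_; refl; sym; trans; cong; subst; resp₂; isEquivalence; module ≡-Reasoning)
open import Relation.Binary.Construct.Closure.Transitive using (TransClosure; [_]; _∷_; _++_)
open import Relation.Binary.Construct.Closure.ReflexiveTransitive using (Star; ε; _◅_; _◅◅_; fold)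
open import Relation.Binary.Construct.Closure.Symmetric using (SymClosure; fwd; bwd)
import Induction.WellFounded as WF
open import Level using (0ℓ)
open import Function using (flip)

Diamond : {V : Set} → Rel V 0ℓ → Set
Diamond {V} _⟶_ = ∀ {v u w : V} → u ≢ w → v ⟶ u → v ⟶ w → ∃ λ z → u ⟶ z × w ⟶ z

UColoring⇒diamond : ∀ {n C} {R : Rel (Fin n) 0ℓ} {c : Fin n → Fin n → C} →
                    IsUColoring R c → Diamond R
UColoring⇒diamond col u≢w v⟶u v⟶w =
  let (_ , z , u⟶z , w⟶z , _) = col _ _ _ u≢w v⟶u v⟶w in z , u⟶z , w⟶z

IsUColoring-resp : ∀ {n C} {R S : Rel (Fin n) 0ℓ} {c : Fin n → Fin n → C} →
                   (∀ {x y} → S x y → R x y) → (∀ {x y} → R x y → S x y) →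
                   IsUColoring R c → IsUColoring S c
IsUColoring-resp S⇒R R⇒S col u v w u≢w Svu Svw =
  let (c-distinct , z , Ruz , Rwz , c-swap) = col u v w u≢w (S⇒R Svu) (S⇒R Svw)
  in c-distinct , z , R⇒S Ruz , R⇒S Rwz , c-swap

covers⁺⇒step : ∀ {n} {R : Rel (Fin n) 0ℓ} {x y} → Covers (TransClosure R) x y → R x y
covers⁺⇒step ([ x⟶y ] , _)        = x⟶y
covers⁺⇒step ((x⟶z ∷ z⟶⁺y) , no-z) = ⊥-elim (no-z (_ , [ x⟶z ] , z⟶⁺y))

module UniqueSinks {n} (_⟶_ : Rel (Fin n) 0ℓ) (_⟶?_ : Decidable _⟶_)
  (acyclic : ∀ x → ¬ TransClosure _⟶_ x x) (diamond : Diamond _⟶_) where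

  data Path : Fin n → Fin n → ℕ → Set where
    []  : ∀ {x} → Path x x 0
    _∷_ : ∀ {x y z k} → x ⟶ y → Path y z k → Path x z (suc k)

  Sink : Fin n → Set
  Sink t = ∀ y → ¬ t ⟶ y

  record UniqueSink (x : Fin n) : Set where
    field
      target        : Fin n
      distance      : ℕ
      path          : Path x target distance
      target-isSink : Sink target
      unique        : ∀ {t k} → Sink t → Path x t k → t ≡ target × k ≡ distance

  open UniqueSink

  descend : ∀ {y z} → y ⟶ z → (U : UniqueSink y) (W : UniqueSink z) →
            target W ≡ target U × suc (distance W) ≡ distance U
  descend y⟶z U W = unique U (target-isSink W) (y⟶z ∷ path W)

  meet : ∀ {y y' z} → y ⟶ z → y' ⟶ z → (U : UniqueSink y) (U' : UniqueSink y') →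
         UniqueSink z → target U' ≡ target U × distance U' ≡ distance U
  meet y⟶z y'⟶z U U' W =
    let (t≡t , d≡d) = descend y⟶z U W ; (t'≡t , d'≡d) = descend y'⟶z U' W
    in trans (sym t'≡t) t≡t , trans (sym d'≡d) d≡d

  noetherian : WF.WellFounded (flip (TransClosure _⟶_))
  noetherian = spo-noetherian record
    { isEquivalence = isEquivalence
    ; irrefl        = λ { refl x⟶⁺x → acyclic _ x⟶⁺x }
    ; trans         = _++_
    ; <-resp-≈      = resp₂ (TransClosure _⟶_)
    }

  uniqueSink : ∀ x → UniqueSink x
  uniqueSink = WF.All.wfRec noetherian _ UniqueSink extend
    where
    extend : ∀ x → (∀ {y} → TransClosure _⟶_ x y → UniqueSink y) → UniqueSink x
    extend x IH with any? (x ⟶?_)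
    ... | no ∄y = record
      { target = x ; distance = 0 ; path = [] ; target-isSink = λ y x⟶y → ∄y (y , x⟶y)
      ; unique = λ { _ [] → refl , refl ; _ (x⟶y ∷ _) → ⊥-elim (∄y (_ , x⟶y)) } }
    ... | yes (y , x⟶y) = record
      { target = target U ; distance = suc (distance U) ; path = x⟶y ∷ path U
      ; target-isSink = target-isSink U ; unique = unique-via-y }
      where
      U : UniqueSink y
      U = IH [ x⟶y ]

      unique-via-y : ∀ {t k} → Sink t → Path x t k → t ≡ target U × k ≡ suc (distance U)
      unique-via-y t-sink [] = ⊥-elim (t-sink y x⟶y)
      unique-via-y {k = suc k} t-sink (_∷_ {y = y'} x⟶y' y'⇝t) with y' ≟ y
      ... | yes refl = let (t≡ , k≡) = unique U t-sink y'⇝t in t≡ , cong suc k≡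
      ... | no y'≢y =
        let (z , y'⟶z , y⟶z) = diamond y'≢y x⟶y' x⟶y
            U' = IH [ x⟶y' ]
            (t≡ , k≡) = unique U' t-sink y'⇝t
            (t'≡ , d'≡) = meet y⟶z y'⟶z U U' (IH (x⟶y ∷ [ y⟶z ]))
        in trans t≡ t'≡ , cong suc (trans k≡ d'≡)

  sink : Fin n → Fin n
  sink x = target (uniqueSink x)

  height : Fin n → ℕ
  height x = distance (uniqueSink x)

  height-arc : ∀ {x y} → x ⟶ y → height x ≡ suc (height y)
  height-arc x⟶y = sym (proj₂ (descend x⟶y (uniqueSink _) (uniqueSink _)))

  sink-arc : ∀ {x y} → x ⟶ y → sink y ≡ sink x
  sink-arc x⟶y = proj₁ (descend x⟶y (uniqueSink _) (uniqueSink _))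

  path⇒star : ∀ {x y k} → Path x y k → Star _⟶_ x y
  path⇒star []           = ε
  path⇒star (x⟶y ∷ y⇝z) = x⟶y ◅ path⇒star y⇝z

  reaches-sink : ∀ x → Star _⟶_ x (sink x)
  reaches-sink x = path⇒star (path (uniqueSink x))

  sink-resp-edge : ∀ {x y} → SymClosure _⟶_ x y → sink x ≡ sink y
  sink-resp-edge (fwd x⟶y) = sym (sink-arc x⟶y)
  sink-resp-edge (bwd y⟶x) = sink-arc y⟶x

  sink-resp-connection : ∀ {x y} → Star (SymClosure _⟶_) x y → sink x ≡ sink y
  sink-resp-connection = fold (λ x y → sink x ≡ sink y) (λ e eq → trans (sink-resp-edge e) eq) refl

  greatest : Fin n → (∀ x y → Star (SymClosure _⟶_) x y) → HasGreatest (Star _⟶_)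
  greatest x₀ connected = sink x₀ , λ x →
    subst (Star _⟶_ x) (sink-resp-connection (connected x x₀)) (reaches-sink x)

module Graded {n} (_⟶_ : Rel (Fin n) 0ℓ) (h : Fin n → ℕ)
  (h-arc : ∀ {x y} → x ⟶ y → h x ≡ suc (h y)) where

  h-⁺ : ∀ {x y} → TransClosure _⟶_ x y → h y < h x
  h-⁺ [ x⟶y ]         = ≤-reflexive (sym (h-arc x⟶y))
  h-⁺ (x⟶z ∷ z⟶⁺y) = <-trans (h-⁺ z⟶⁺y) (≤-reflexive (sym (h-arc x⟶z)))

  h-⋆ : ∀ {x y} → Star _⟶_ x y → h y ≤ h x
  h-⋆ ε               = ≤-refl
  h-⋆ (x⟶z ◅ z⟶⋆y) = ≤-trans (h-⋆ z⟶⋆y) (≤-trans (n≤1+n _) (≤-reflexive (sym (h-arc x⟶z))))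

  arc⇒covers : ∀ {x y} → x ⟶ y → Covers (TransClosure _⟶_) x y
  arc⇒covers x⟶y = [ x⟶y ] , λ (z , x⟶⁺z , z⟶⁺y) →
    <⇒≱ (h-⁺ z⟶⁺y) (m<1+n⇒m≤n (subst (h _ <_) (h-arc x⟶y) (h-⁺ x⟶⁺z)))

  antisym : ∀ {x y} → Star _⟶_ x y → Star _⟶_ y x → x ≡ y
  antisym ε              _       = refl
  antisym (x⟶z ◅ z⟶⋆y) y⟶⋆x =
    ⊥-elim (1+n≰n (subst (_≤ h _) (h-arc x⟶z) (h-⋆ (z⟶⋆y ◅◅ y⟶⋆x))))

  isPartialOrder : IsPartialOrder _≡_ (Star _⟶_)
  isPartialOrder = record
    { isPreorder = record
      { isEquivalence = isEquivalence
      ; reflexive     = λ { refl → ε }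
      ; trans         = _◅◅_
      }
    ; antisym = antisym
    }

  top : ℕ
  top = max 0 (map h (allFin n))

  h≤top : ∀ x → h x ≤ top
  h≤top x = lookup (xs≤max 0 (map h (allFin n))) (∈-map⁺ h (∈-allFin x))

  rank : HasRankFunction (TransClosure _⟶_)
  rank = (λ x → top ∸ h x) , λ x y x⋖y → rank-step (covers⁺⇒step x⋖y)
    where
    open ≡-Reasoning
    rank-step : ∀ {x y} → x ⟶ y → top ∸ h y ≡ suc (top ∸ h x)
    rank-step {x} {y} x⟶y = begin
      top ∸ h y             ≡⟨ +-∸-assoc 1 (subst (_≤ top) (h-arc x⟶y) (h≤top x)) ⟩
      suc (top ∸ suc (h y)) ≡⟨ cong (λ m → suc (top ∸ m)) (sym (h-arc x⟶y)) ⟩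
      suc (top ∸ h x)       ∎

corollary1 : (n : ℕ) (A : Digraph n) (C : Set) (c : Fin n → Fin n → C) →
    Connected A → Acyclic A → IsUColoring (Arc A) c →
    IsCoverGraphOfClosure A × IsPartialOrder _≡_ (_≤D_ A) × IsUPoset (_<D_ A) ×
    HasRankFunction (_<D_ A) × HasGreatest (_≤D_ A)
corollary1 n A C c (x₀ , connected) acyclic col =
  (λ _ _ → arc⇒covers , covers⁺⇒step) ,
  isPartialOrder ,
  (C , c , IsUColoring-resp covers⁺⇒step arc⇒covers col) ,
  rank ,
  greatest x₀ connected
  where
  open UniqueSinks (Arc A) (λ x y → A x y Bool.≟ true) acyclic (UColoring⇒diamond col)
  open Graded (Arc A) height height-arc
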